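{- Let $\Gamma$ be a strongly regular graph with parameters $(v,k,\lambda,\mu)$ with $\mu\ne 0$ and restricted eigenvalues $\rho>\sigma$, and let $d$ be an integer with $0\le d\le k$. Then for every $y$ with $0<y<\mathrm{Haem}_{\leq}(\Gamma,d)$ or $\mathrm{Haem}_{\geq}(\Gamma,d)<y<v$ there is an integer $b_y$ such that $R_\Gamma(b_y,y,d)<0$.
   Context: A graph is strongly regular with parameters $(v,k,\lambda,\mu)$ if it has $v$ vertices, is $k$-regular, is neither complete nor edgeless, every two adjacent vertices have exactly $\lambda$ common neighbours, and every two distinct non-adjacent vertices have exactly $\mu$ common neighbours. Its restricted eigenvalues $\rho>\sigma$ are the two roots of $t^2-(\lambda-\mu)t-(k-\mu)=0$. Define $\mathrm{Haem}_{\geq}(\Gamma,d)=v\frac{d-\sigma}{k-\sigma}$ and $\mathrm{Haem}_{\leq}(\Gamma,d)=v\frac{d-\rho}{k-\rho}$. The regular adjacency polynomial is $R_\Gamma(x,y,d)=x(x+1)(v-y)-2xyk+(2x+\lambda-\mu+1)yd+y(y-1)\mu-yd^2$. -}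

module Defs where

open import Data.Nat as ℕ using (ℕ; zero; suc)
open import Data.Integer as ℤ using (ℤ; +_)
open import Data.Rational as ℚ using (ℚ; _/_; ½)
open import Data.Bool using (Bool; true; false; if_then_else_; _∧_)
open import Data.Fin using (Fin; zero; suc)
open import Data.Product using (_×_; ∃-syntax; _,_)
open import Data.Sum using (_⊎_)
open import Relation.Binary.PropositionalEquality using (_≡_; _≢_)
open import Function using (_∘_)

record Graph (n : ℕ) : Set where
  field
    adj    : Fin n → Fin n → Bool
    sym    : ∀ i j → adj i j ≡ adj j i
    irrefl : ∀ i → adj i i ≡ false
open Graph public

count : ∀ {n} → (Fin n → Bool) → ℕ
count {zero}  f = 0
count {suc n} f = (if f zero then 1 else 0) ℕ.+ count (f ∘ suc)

degree : ∀ {n} → Graph n → Fin n → ℕ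
degree G i = count (adj G i)

commonNbrs : ∀ {n} → Graph n → Fin n → Fin n → ℕ
commonNbrs G i j = count (λ w → adj G i w ∧ adj G j w)

record IsSRG {v : ℕ} (G : Graph v) (k lam mu : ℕ) : Set where
  field
    regular     : ∀ i → degree G i ≡ k
    notComplete : ∃[ i ] ∃[ j ] (i ≢ j × adj G i j ≡ false)
    notEdgeless : ∃[ i ] ∃[ j ] (adj G i j ≡ true)
    adjCommon   : ∀ i j → adj G i j ≡ true → commonNbrs G i j ≡ lam
    nonadjCommon : ∀ i j → i ≢ j → adj G i j ≡ false → commonNbrs G i j ≡ mu

-- Exact real arithmetic in ℚ(√D): a pair (a , b) denotes a + b·√D.

record Surd : Set where
  constructor _+√_
  field
    re : ℚ
    im : ℚ
open Surd public

ofℚ : ℚ → Surd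
ofℚ a = a +√ ℚ.0ℚ

ofℤ : ℤ → Surd
ofℤ z = ofℚ (z / 1)

module _ (D : ℤ) where
  private Dq = D / 1

  _⊕_ : Surd → Surd → Surd
  (a +√ b) ⊕ (c +√ e) = (a ℚ.+ c) +√ (b ℚ.+ e)

  ⊖_ : Surd → Surd
  ⊖ (a +√ b) = (ℚ.- a) +√ (ℚ.- b)

  _⊝_ : Surd → Surd → Surd
  x ⊝ y = x ⊕ (⊖ y)

  _⊗_ : Surd → Surd → Surd
  (a +√ b) ⊗ (c +√ e) = (a ℚ.* c ℚ.+ b ℚ.* e ℚ.* Dq) +√ (a ℚ.* e ℚ.+ b ℚ.* c)

  -- a + b√D > 0  (for D ≥ 0)
  Pos : Surd → Set
  Pos (a +√ b) =
      (ℚ.0ℚ ℚ.< a × (ℚ.0ℚ ℚ.≤ b ⊎ b ℚ.* b ℚ.* Dq ℚ.< a ℚ.* a))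
    ⊎ (a ℚ.≤ ℚ.0ℚ × ℚ.0ℚ ℚ.< b × a ℚ.* a ℚ.< b ℚ.* b ℚ.* Dq)

  _≺_ : Surd → Surd → Set
  x ≺ y = Pos (y ⊝ x)

  -- y < p / q  (false when q = 0, i.e. when the quotient is undefined)
  _≺_÷_ : Surd → Surd → Surd → Set
  y ≺ p ÷ q = (Pos q × (y ⊗ q) ≺ p) ⊎ (Pos (⊖ q) × p ≺ (y ⊗ q))

  _÷_≺_ : Surd → Surd → Surd → Set
  p ÷ q ≺ y = (Pos q × p ≺ (y ⊗ q)) ⊎ (Pos (⊖ q) × (y ⊗ q) ≺ p)

-- Restricted eigenvalues: roots of t² - (lam - mu) t - (k - mu) = 0,
-- i.e. ((lam - mu) ± √D)/2 with D = (lam - mu)² + 4 (k - mu).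

disc : ℕ → ℕ → ℕ → ℤ
disc k lam mu = (+ lam ℤ.- + mu) ℤ.* (+ lam ℤ.- + mu) ℤ.+ + 4 ℤ.* (+ k ℤ.- + mu)

ρ : ℕ → ℕ → Surd
ρ lam mu = ((+ lam ℤ.- + mu) / 2) +√ ½

σ : ℕ → ℕ → Surd
σ lam mu = ((+ lam ℤ.- + mu) / 2) +√ (ℚ.- ½)

-- y < Haem_≤(Γ,d) = v (d - ρ)/(k - ρ)
BelowHaemLe : (v k lam mu : ℕ) → (d y : ℤ) → Set
BelowHaemLe v k lam mu d y =
  _≺_÷_ D (ofℤ y) (_⊗_ D (ofℤ (+ v)) (_⊝_ D (ofℤ d) (ρ lam mu)))
                  (_⊝_ D (ofℤ (+ k)) (ρ lam mu))
  where D = disc k lam mu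

-- Haem_≥(Γ,d) = v (d - σ)/(k - σ) < y
AboveHaemGe : (v k lam mu : ℕ) → (d y : ℤ) → Set
AboveHaemGe v k lam mu d y =
  _÷_≺_ D (_⊗_ D (ofℤ (+ v)) (_⊝_ D (ofℤ d) (σ lam mu)))
          (_⊝_ D (ofℤ (+ k)) (σ lam mu)) (ofℤ y)
  where D = disc k lam mu

R : (v k lam mu : ℕ) → (x y d : ℤ) → ℤ
R v k lam mu x y d =
  x ℤ.* (x ℤ.+ + 1) ℤ.* (+ v ℤ.- y)
  ℤ.- + 2 ℤ.* x ℤ.* y ℤ.* + k
  ℤ.+ (+ 2 ℤ.* x ℤ.+ + lam ℤ.- + mu ℤ.+ + 1) ℤ.* y ℤ.* d
  ℤ.+ y ℤ.* (y ℤ.- + 1) ℤ.* + mu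
  ℤ.- y ℤ.* d ℤ.* d

-- Write L = λ - μ and D = L² + 4 (k - μ), so that 2ρ, 2σ = L ± √D, and put
-- A = v (2d - L) - y (2k - L) and B = y - v.  Then 2 (v (d - ρ) - y (k - ρ)) = A + B √D and
-- 2 (y (k - σ) - v (d - σ)) = -A + B √D.  As σ ≤ 0 and ρ ≤ k (because (k - ρ)(k - σ) = μ v),
-- either hypothesis on y amounts to 0 < y < v and B² D < A².  As a polynomial in x,
-- R(x, y, d) has leading coefficient v - y > 0, and the strongly regular identity
-- k (k - λ - 1) = μ (v - k - 1) gives its discriminant Δ as v (Δ - (v - y)²) = y (A² - B² D) > 0.
-- So the two real roots are more than 1 apart, and an integer b lies strictly between them.
module Submission where

open import Defs
open import Data.Nat as ℕ using (ℕ; suc)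
import Data.Nat.Properties as ℕ
open import Data.Product using (_×_; _,_; proj₂; ∃-syntax)
open import Data.Sum using (_⊎_; inj₁; inj₂)
open import Data.Empty using (⊥-elim)
open import Data.List using (_∷_; [])
open import Relation.Nullary using (¬_; contradiction; yes; no)
open import Relation.Binary.PropositionalEquality hiding (sym)
import Relation.Binary.PropositionalEquality as ≡

module Counting where

  open import Data.Nat using (zero; _+_; _*_; _≤_; z≤n; s≤s)
  open import Data.Nat.Tactic.RingSolver using (solve-∀)
  open import Data.Bool using (Bool; true; false; not; _∧_; if_then_else_)
  open import Data.Bool.Properties using (∧-idem)
  open import Data.Fin using (Fin; zero; suc; _≟_)
  open import Function using (_∘_)
  open import Relation.Nullary using (does)
  open import Algebra.Properties.Semiring.Sum ℕ.+-*-semiring using (sum; sum-cong-≗; ∑-comm; ∑-distrib-+; *-distribˡ-sum)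

  ⟦_⟧ : Bool → ℕ
  ⟦ b ⟧ = if b then 1 else 0

  ⟦∧⟧ : ∀ a b → ⟦ a ∧ b ⟧ ≡ ⟦ a ⟧ * ⟦ b ⟧
  ⟦∧⟧ true  b = ≡.sym (ℕ.+-identityʳ ⟦ b ⟧)
  ⟦∧⟧ false b = refl

  count≡sum : ∀ {n} (f : Fin n → Bool) → count f ≡ sum (λ i → ⟦ f i ⟧)
  count≡sum {zero}  f = refl
  count≡sum {suc n} f = cong (⟦ f zero ⟧ +_) (count≡sum (f ∘ suc))

  count-cong : ∀ {n} {f g : Fin n → Bool} → (∀ i → f i ≡ g i) → count f ≡ count g
  count-cong {zero}  f≗g = refl
  count-cong {suc n} f≗g = cong₂ (λ b c → (if b then 1 else 0) + c) (f≗g zero) (count-cong (f≗g ∘ suc))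

  sum-⟦⟧* : ∀ {n} (f : Fin n → Bool) c → sum (λ i → ⟦ f i ⟧ * c) ≡ count f * c
  sum-⟦⟧* {zero}  f c = refl
  sum-⟦⟧* {suc n} f c = trans (cong (⟦ f zero ⟧ * c +_) (sum-⟦⟧* (f ∘ suc) c))
                              (≡.sym (ℕ.*-distribʳ-+ c ⟦ f zero ⟧ (count (f ∘ suc))))

  count-∧ˡ≤ : ∀ {n} (f g : Fin n → Bool) → count (λ i → f i ∧ g i) ≤ count f
  count-∧ˡ≤ {zero}  f g = z≤n
  count-∧ˡ≤ {suc n} f g with f zero | g zero
  ... | true  | true  = s≤s (count-∧ˡ≤ (f ∘ suc) (g ∘ suc))
  ... | true  | false = ℕ.m≤n⇒m≤1+n (count-∧ˡ≤ (f ∘ suc) (g ∘ suc))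
  ... | false | _     = count-∧ˡ≤ (f ∘ suc) (g ∘ suc)

  count+count-not : ∀ {n} (f : Fin n → Bool) → count f + count (not ∘ f) ≡ n
  count+count-not {zero}  f = refl
  count+count-not {suc n} f with f zero
  ... | true  = cong suc (count+count-not (f ∘ suc))
  ... | false = trans (ℕ.+-suc _ _) (cong suc (count+count-not (f ∘ suc)))

  count-≟ : ∀ {n} (i : Fin n) → count (λ j → does (j ≟ i)) ≡ 1
  count-≟ {suc n} zero    = cong suc (count-false n)
    where
    count-false : ∀ n → count {n} (λ _ → false) ≡ 0
    count-false zero    = refl
    count-false (suc n) = count-false n
  count-≟ {suc n} (suc i) = count-≟ i

  module _ {v : ℕ} {G : Graph v} {k lam mu : ℕ} (srg : IsSRG G k lam mu) where
    open IsSRG srg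

    lam≤k : lam ≤ k
    lam≤k with notEdgeless
    ... | i , j , i~j = subst₂ _≤_ (adjCommon i j i~j) (regular i) (count-∧ˡ≤ (adj G i) (adj G j))

    mu≤k : mu ≤ k
    mu≤k with notComplete
    ... | i , j , i≢j , i≁j = subst₂ _≤_ (nonadjCommon i j i≢j i≁j) (regular i) (count-∧ˡ≤ (adj G i) (adj G j))

    -- both sides count the walks of length two starting at i
    sum-commonNbrs : ∀ i → sum (commonNbrs G i) ≡ k * k
    sum-commonNbrs i = begin
      sum (λ w → count (λ u → adj G i u ∧ adj G w u))
        ≡⟨ sum-cong-≗ (λ w → trans (count≡sum (λ u → adj G i u ∧ adj G w u)) (sum-cong-≗ (λ u → ⟦∧⟧ (adj G i u) (adj G w u)))) ⟩
      sum (λ w → sum (λ u → ⟦ adj G i u ⟧ * ⟦ adj G w u ⟧))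
        ≡⟨ ∑-comm (λ w u → ⟦ adj G i u ⟧ * ⟦ adj G w u ⟧) ⟩
      sum (λ u → sum (λ w → ⟦ adj G i u ⟧ * ⟦ adj G w u ⟧))
        ≡⟨ sum-cong-≗ (λ u → ≡.sym (*-distribˡ-sum ⟦ adj G i u ⟧ (λ w → ⟦ adj G w u ⟧))) ⟩
      sum (λ u → ⟦ adj G i u ⟧ * sum (λ w → ⟦ adj G w u ⟧))
        ≡⟨ sum-cong-≗ (λ u → cong (⟦ adj G i u ⟧ *_) (degree≡k u)) ⟩
      sum (λ u → ⟦ adj G i u ⟧ * k)
        ≡⟨ sum-⟦⟧* (adj G i) k ⟩
      count (adj G i) * k
        ≡⟨ cong (_* k) (regular i) ⟩
      k * k ∎
      where
      open ≡-Reasoning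
      degree≡k : ∀ u → sum (λ w → ⟦ adj G w u ⟧) ≡ k
      degree≡k u = begin
        sum (λ w → ⟦ adj G w u ⟧) ≡⟨ sum-cong-≗ (λ w → cong ⟦_⟧ (Graph.sym G w u)) ⟩
        sum (λ w → ⟦ adj G u w ⟧) ≡⟨ count≡sum (adj G u) ⟨
        count (adj G u)           ≡⟨ regular u ⟩
        k                         ∎

    commonNbrs-cases : ∀ i w → commonNbrs G i w + ⟦ does (w ≟ i) ⟧ * mu
                             ≡ ⟦ does (w ≟ i) ⟧ * k + ⟦ adj G i w ⟧ * lam + ⟦ not (adj G i w) ⟧ * mu
    commonNbrs-cases i w with w ≟ i
    ... | yes refl rewrite Graph.irrefl G i = trans (cong (_+ 1 * mu) ii≡k) (lemma k lam mu)
      where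
      ii≡k : commonNbrs G i i ≡ k
      ii≡k = trans (count-cong (λ u → ∧-idem (adj G i u))) (regular i)
      lemma : ∀ k lam mu → k + 1 * mu ≡ 1 * k + 0 * lam + 1 * mu
      lemma = solve-∀
    ... | no w≢i with adj G i w in i~w
    ...   | true  = trans (cong (_+ 0 * mu) (adjCommon i w i~w)) (lemma k lam mu)
      where
      lemma : ∀ k lam mu → lam + 0 * mu ≡ 0 * k + 1 * lam + 0 * mu
      lemma = solve-∀
    ...   | false = trans (cong (_+ 0 * mu) (nonadjCommon i w (w≢i ∘ ≡.sym) i~w)) (lemma k lam mu)
      where
      lemma : ∀ k lam mu → mu + 0 * mu ≡ 0 * k + 0 * lam + 1 * mu
      lemma = solve-∀

    srg-identity : k * k + mu * (k + 1) ≡ k * (lam + 1) + mu * v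
    srg-identity with notEdgeless
    ... | i , _ = begin
      k * k + mu * (k + 1)                                 ≡⟨ lemma k mu ⟩
      (k * k + 1 * mu) + mu * k                            ≡⟨ cong (_+ mu * k) walks ⟩
      (1 * k + k * lam + N * mu) + mu * k                  ≡⟨ lemma′ k lam mu N ⟩
      k * (lam + 1) + mu * (k + N)                         ≡⟨ cong (λ n → k * (lam + 1) + mu * n) k+N≡v ⟩
      k * (lam + 1) + mu * v                               ∎
      where
      open ≡-Reasoning
      [w≟i] [i~w] [i≁w] : Fin v → ℕ
      [w≟i] w = ⟦ does (w ≟ i) ⟧
      [i~w] w = ⟦ adj G i w ⟧
      [i≁w] w = ⟦ not (adj G i w) ⟧
      N : ℕ
      N = count (not ∘ adj G i)
      k+N≡v : k + N ≡ v
      k+N≡v = trans (cong (_+ N) (≡.sym (regular i))) (count+count-not (adj G i))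
      walks : k * k + 1 * mu ≡ 1 * k + k * lam + N * mu
      walks = begin
        k * k + 1 * mu
          ≡⟨ cong₂ _+_ (sum-commonNbrs i) (cong (_* mu) (count-≟ i)) ⟨
        sum (commonNbrs G i) + count (λ w → does (w ≟ i)) * mu
          ≡⟨ cong (sum (commonNbrs G i) +_) (sum-⟦⟧* (λ w → does (w ≟ i)) mu) ⟨
        sum (commonNbrs G i) + sum (λ w → [w≟i] w * mu)
          ≡⟨ ∑-distrib-+ (commonNbrs G i) (λ w → [w≟i] w * mu) ⟨
        sum (λ w → commonNbrs G i w + [w≟i] w * mu)
          ≡⟨ sum-cong-≗ (commonNbrs-cases i) ⟩
        sum (λ w → [w≟i] w * k + [i~w] w * lam + [i≁w] w * mu)
          ≡⟨ ∑-distrib-+ (λ w → [w≟i] w * k + [i~w] w * lam) (λ w → [i≁w] w * mu) ⟩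
        sum (λ w → [w≟i] w * k + [i~w] w * lam) + sum (λ w → [i≁w] w * mu)
          ≡⟨ cong (_+ sum (λ w → [i≁w] w * mu)) (∑-distrib-+ (λ w → [w≟i] w * k) (λ w → [i~w] w * lam)) ⟩
        sum (λ w → [w≟i] w * k) + sum (λ w → [i~w] w * lam) + sum (λ w → [i≁w] w * mu)
          ≡⟨ cong₂ _+_ (cong₂ _+_ (sum-⟦⟧* (λ w → does (w ≟ i)) k) (sum-⟦⟧* (adj G i) lam)) (sum-⟦⟧* (not ∘ adj G i) mu) ⟩
        count (λ w → does (w ≟ i)) * k + count (adj G i) * lam + N * mu
          ≡⟨ cong₂ (λ a b → a * k + b * lam + N * mu) (count-≟ i) (regular i) ⟩
        1 * k + k * lam + N * mu ∎
      lemma : ∀ k mu → k * k + mu * (k + 1) ≡ (k * k + 1 * mu) + mu * k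
      lemma = solve-∀
      lemma′ : ∀ k lam mu N → (1 * k + k * lam + N * mu) + mu * k ≡ k * (lam + 1) + mu * (k + N)
      lemma′ = solve-∀

open Counting using (lam≤k; mu≤k; srg-identity)

open import Data.Integer as ℤ using (ℤ; +_; 0ℤ; _+_; _-_; _*_; -_; _≤_; _<_; +<+; +≤+)
import Data.Integer.Properties as ℤ
open import Data.Integer.DivMod using (_/ℕ_; _%ℕ_; a≡a%ℕn+[a/ℕn]*n; n%ℕd<d)
open import Data.Integer.Tactic.RingSolver using (solve; solve-∀)
open import Data.Rational as ℚ using (ℚ; ½; toℚᵘ)
import Data.Rational.Properties as ℚ
open import Data.Rational.Unnormalised as ℚᵘ using (ℚᵘ; mkℚᵘ; *≡*; *≤*; *<*) renaming (_≃_ to _≃ᵘ_)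
import Data.Rational.Unnormalised.Properties as ℚᵘ

≡-modulo : ∀ {a b s t : ℤ} c → a - b ≡ c * (s - t) → s ≡ t → a ≡ b
≡-modulo {a} {b} {s} c eq refl = ℤ.i-j≡0⇒i≡j a b (begin
  a - b         ≡⟨ eq ⟩
  c * (s - s)   ≡⟨ cong (c *_) (ℤ.+-inverseʳ s) ⟩
  c * 0ℤ        ≡⟨ ℤ.*-zeroʳ c ⟩
  0ℤ            ∎)
  where open ≡-Reasoning

0≤+ : ∀ n → 0ℤ ≤ + n
0≤+ n = +≤+ ℕ.z≤n

*-nonNeg : ∀ {x y} → 0ℤ ≤ x → 0ℤ ≤ y → 0ℤ ≤ x * y
*-nonNeg {x} {y} 0≤x 0≤y =
  ℤ.≤-trans (ℤ.≤-reflexive (≡.sym (ℤ.*-zeroˡ y))) (ℤ.*-monoʳ-≤-nonNeg y {{ℤ.nonNegative 0≤y}} 0≤x)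

*-pos : ∀ {x y} → 0ℤ < x → 0ℤ < y → 0ℤ < x * y
*-pos {x} {y} 0<x 0<y = subst (_< x * y) (ℤ.*-zeroʳ x) (ℤ.*-monoˡ-<-pos x {{ℤ.positive 0<x}} 0<y)

0<i*j⇒0<j : ∀ {i j} → 0ℤ ≤ i → 0ℤ < i * j → 0ℤ < j
0<i*j⇒0<j {i} {j} 0≤i 0<ij = ℤ.*-cancelˡ-<-nonNeg i {{ℤ.nonNegative 0≤i}} (subst (_< i * j) (≡.sym (ℤ.*-zeroʳ i)) 0<ij)

i≤i+nonNeg : ∀ {i j} → 0ℤ ≤ j → i ≤ i + j
i≤i+nonNeg {i} {j} 0≤j = ℤ.i≤i+j i j {{ℤ.nonNegative 0≤j}}

+≤0⇒≤- : ∀ {i j} → i + j ≤ 0ℤ → i ≤ - j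
+≤0⇒≤- {i} {j} i+j≤0 = begin
  i              ≡⟨ lemma i j ⟩
  (i + j) - j    ≤⟨ ℤ.+-monoˡ-≤ (- j) i+j≤0 ⟩
  0ℤ - j         ≡⟨ ℤ.+-identityˡ (- j) ⟩
  - j            ∎
  where
  open ℤ.≤-Reasoning
  lemma : ∀ i j → i ≡ (i + j) - j
  lemma = solve-∀

i<j⇒i-j<0 : ∀ {i j} → i < j → i - j < 0ℤ
i<j⇒i-j<0 {i} {j} i<j = subst (i - j <_) (ℤ.+-inverseʳ j) (ℤ.+-monoˡ-< (- j) i<j)

i<j⇒0<j-i : ∀ {i j} → i < j → 0ℤ < j - i
i<j⇒0<j-i {i} {j} i<j = subst (_< j - i) (ℤ.+-inverseʳ i) (ℤ.+-monoˡ-< (- i) i<j)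

0<j-i⇒i<j : ∀ {i j} → 0ℤ < j - i → i < j
0<j-i⇒i<j {i} {j} 0<j-i = subst₂ _<_ (ℤ.+-identityʳ i) (lemma i j) (ℤ.+-monoʳ-< i 0<j-i)
  where
  lemma : ∀ i j → i + (j - i) ≡ j
  lemma = solve-∀

neg-square : ∀ x → - x * - x ≡ x * x
neg-square = solve-∀

square-nonNeg : ∀ x → 0ℤ ≤ x * x
square-nonNeg x with ℤ.≤-total 0ℤ x
... | inj₁ 0≤x = *-nonNeg 0≤x 0≤x
... | inj₂ x≤0 = subst (0ℤ ≤_) (neg-square x) (*-nonNeg (ℤ.neg-mono-≤ x≤0) (ℤ.neg-mono-≤ x≤0))

square-mono-≤ : ∀ {x y} → 0ℤ ≤ x → x ≤ y → x * x ≤ y * y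
square-mono-≤ {x} {y} 0≤x x≤y = ℤ.≤-trans
  (ℤ.*-monoʳ-≤-nonNeg x {{ℤ.nonNegative 0≤x}} x≤y)
  (ℤ.*-monoˡ-≤-nonNeg y {{ℤ.nonNegative (ℤ.≤-trans 0≤x x≤y)}} x≤y)

-- Completing the square: at x = ⌊(a - β)/2a⌋ one has -a < 2ax + β ≤ a, so
-- 4a(ax² + βx + C) = (2ax + β)² - (β² - 4aC) < a² - a² = 0.
quadratic-negative : ∀ (a β C : ℤ) → 0ℤ < a → a * a < β * β - + 4 * a * C →
                     ∃[ x ] a * x * x + β * x + C < 0ℤ
quadratic-negative (+ 0) β C (+<+ ()) gap
quadratic-negative (+ suc n) β C _ gap = x , ℤ.≰⇒> Q≱0
  where
  a Δ x r Q : ℤ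
  a = + suc n
  Δ = β * β - + 4 * a * C
  x = (a - β) /ℕ (suc n ℕ.+ suc n)
  r = + ((a - β) %ℕ (suc n ℕ.+ suc n))
  Q = a * x * x + β * x + C

  vertex : + 2 * a * x + β ≡ a - r
  vertex = ≡-modulo (- + 1) (lemma a β x r) (a≡a%ℕn+[a/ℕn]*n (a - β) (suc n ℕ.+ suc n))
    where
    lemma : ∀ a β x r → (+ 2 * a * x + β) - (a - r) ≡ - + 1 * ((a - β) - (r + x * (a + a)))
    lemma = solve-∀

  completing-square : Δ + + 4 * a * Q ≡ (+ 2 * a * x + β) * (+ 2 * a * x + β)
  completing-square = lemma a β C x
    where
    lemma : ∀ a β C x → (β * β - + 4 * a * C) + + 4 * a * (a * x * x + β * x + C)
                      ≡ (+ 2 * a * x + β) * (+ 2 * a * x + β)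
    lemma = solve-∀

  0≤r : 0ℤ ≤ r
  0≤r = 0≤+ _

  r<2a : r < a + a
  r<2a = +<+ (n%ℕd<d (a - β) (suc n ℕ.+ suc n))

  [a-r]²≤a² : (a - r) * (a - r) ≤ a * a
  [a-r]²≤a² = begin
    (a - r) * (a - r)                   ≤⟨ i≤i+nonNeg (*-nonNeg 0≤r (ℤ.i≤j⇒0≤j-i (ℤ.<⇒≤ r<2a))) ⟩
    (a - r) * (a - r) + r * (a + a - r) ≡⟨ lemma a r ⟩
    a * a                               ∎
    where
    open ℤ.≤-Reasoning
    lemma : ∀ a r → (a - r) * (a - r) + r * (a + a - r) ≡ a * a
    lemma = solve-∀

  Q≱0 : ¬ (0ℤ ≤ Q)
  Q≱0 0≤Q = ℤ.<-irrefl refl (begin-strict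
    Δ                                     ≤⟨ i≤i+nonNeg (*-nonNeg {+ 4 * a} (0≤+ _) 0≤Q) ⟩
    Δ + + 4 * a * Q                       ≡⟨ completing-square ⟩
    (+ 2 * a * x + β) * (+ 2 * a * x + β) ≡⟨ cong (λ t → t * t) vertex ⟩
    (a - r) * (a - r)                     ≤⟨ [a-r]²≤a² ⟩
    a * a                                 <⟨ gap ⟩
    Δ                                     ∎)
    where open ℤ.≤-Reasoning

Posℤ : ℤ → ℤ → ℤ → Set
Posℤ D A B = (0ℤ < A × (0ℤ ≤ B ⊎ B * B * D < A * A))
           ⊎ (A ≤ 0ℤ × 0ℤ < B × A * A < B * B * D)

Posℤ-im<0 : ∀ {D A B} → Posℤ D A B → B < 0ℤ → 0ℤ < A × B * B * D < A * A
Posℤ-im<0 (inj₁ (0<A , inj₁ 0≤B)) B<0 = contradiction B<0 (ℤ.≤⇒≯ 0≤B)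
Posℤ-im<0 (inj₁ (0<A , inj₂ gap)) _   = 0<A , gap
Posℤ-im<0 (inj₂ (_ , 0<B , _))    B<0 = contradiction B<0 (ℤ.<-asym 0<B)

-- A + B √D ≤ A + B c ≤ 0 when B ≥ 0 and c ≥ √D
¬Posℤ-by-√D≤c : ∀ {D A B} c → 0ℤ ≤ B → 0ℤ ≤ c → D ≤ c * c → A + B * c ≤ 0ℤ → ¬ Posℤ D A B
¬Posℤ-by-√D≤c {D} {A} {B} c 0≤B 0≤c D≤c² A+Bc≤0 = λ
  { (inj₁ (0<A , _))       → ℤ.≤⇒≯ A≤0 0<A
  ; (inj₂ (_ , _ , A²<B²D)) → ℤ.≤⇒≯ B²D≤A² A²<B²D }
  where
  0≤Bc : 0ℤ ≤ B * c
  0≤Bc = *-nonNeg 0≤B 0≤c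
  Bc≤-A : B * c ≤ - A
  Bc≤-A = +≤0⇒≤- (subst (_≤ 0ℤ) (ℤ.+-comm A (B * c)) A+Bc≤0)
  A≤0 : A ≤ 0ℤ
  A≤0 = ℤ.≤-trans (i≤i+nonNeg 0≤Bc) A+Bc≤0
  B²D≤A² : B * B * D ≤ A * A
  B²D≤A² = begin
    B * B * D            ≤⟨ ℤ.*-monoˡ-≤-nonNeg (B * B) {{ℤ.nonNegative (*-nonNeg 0≤B 0≤B)}} D≤c² ⟩
    B * B * (c * c)      ≡⟨ lemma B c ⟩
    (B * c) * (B * c)    ≤⟨ square-mono-≤ 0≤Bc Bc≤-A ⟩
    (- A) * (- A)        ≡⟨ neg-square A ⟩
    A * A                ∎
    where
    open ℤ.≤-Reasoning
    lemma : ∀ B c → B * B * (c * c) ≡ (B * c) * (B * c)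
    lemma = solve-∀

-- A + B √D ≤ A + B c ≤ 0 when B ≤ 0 and c ≤ √D
¬Posℤ-by-c≤√D : ∀ {D A B} c → B ≤ 0ℤ → c * c ≤ D → A + B * c ≤ 0ℤ → ¬ Posℤ D A B
¬Posℤ-by-c≤√D {D} {A} {B} c B≤0 c²≤D A+Bc≤0 = λ
  { (inj₁ (0<A , inj₁ 0≤B))    → ℤ.≤⇒≯ (subst (λ b → A ≤ - (b * c)) (ℤ.≤-antisym B≤0 0≤B) A≤-Bc) 0<A
  ; (inj₁ (0<A , inj₂ B²D<A²)) → ℤ.≤⇒≯ (A²≤B²D 0<A) B²D<A²
  ; (inj₂ (_ , 0<B , _))       → ℤ.≤⇒≯ B≤0 0<B }
  where
  A≤-Bc : A ≤ - (B * c)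
  A≤-Bc = +≤0⇒≤- A+Bc≤0
  A²≤B²D : 0ℤ < A → A * A ≤ B * B * D
  A²≤B²D 0<A = begin
    A * A                 ≤⟨ square-mono-≤ (ℤ.<⇒≤ 0<A) A≤-Bc ⟩
    - (B * c) * - (B * c) ≡⟨ lemma B c ⟩
    B * B * (c * c)       ≤⟨ ℤ.*-monoˡ-≤-nonNeg (B * B) {{ℤ.nonNegative (square-nonNeg B)}} c²≤D ⟩
    B * B * D             ∎
    where
    open ℤ.≤-Reasoning
    lemma : ∀ B c → - (B * c) * - (B * c) ≡ B * B * (c * c)
    lemma = solve-∀

-- X read in ℚᵘ as p + q √D; unlike ℚ, arithmetic on ℚᵘ literals computes definitionally.
record Represents (X : Surd) (p q : ℚᵘ) : Set where
  constructor represents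
  field
    re≃ : toℚᵘ (re X) ≃ᵘ p
    im≃ : toℚᵘ (im X) ≃ᵘ q

toℚᵘ-/ : ∀ z n → toℚᵘ (z ℚ./ suc n) ≃ᵘ mkℚᵘ z n
toℚᵘ-/ z n = ℚ.toℚᵘ-fromℚᵘ (mkℚᵘ z n)

represents-ofℤ : ∀ z → Represents (ofℤ z) (mkℚᵘ z 0) ℚᵘ.0ℚᵘ
represents-ofℤ z = represents (toℚᵘ-/ z 0) ℚᵘ.≃-refl

ρ′ σ′ : ℤ → Surd
ρ′ L = (L ℚ./ 2) +√ ½
σ′ L = (L ℚ./ 2) +√ (ℚ.- ½)

represents-ρ : ∀ L → Represents (ρ′ L) (mkℚᵘ L 1) (mkℚᵘ (+ 1) 1)
represents-ρ L = represents (toℚᵘ-/ L 1) ℚᵘ.≃-refl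

represents-σ : ∀ L → Represents (σ′ L) (mkℚᵘ L 1) (ℚᵘ.- mkℚᵘ (+ 1) 1)
represents-σ L = represents (toℚᵘ-/ L 1) (ℚ.toℚᵘ-homo‿- ½)

toℚᵘ-+ : ∀ {x y p q} → toℚᵘ x ≃ᵘ p → toℚᵘ y ≃ᵘ q → toℚᵘ (x ℚ.+ y) ≃ᵘ p ℚᵘ.+ q
toℚᵘ-+ {x} {y} x≃p y≃q = ℚᵘ.≃-trans (ℚ.toℚᵘ-homo-+ x y) (ℚᵘ.+-cong x≃p y≃q)

toℚᵘ-* : ∀ {x y p q} → toℚᵘ x ≃ᵘ p → toℚᵘ y ≃ᵘ q → toℚᵘ (x ℚ.* y) ≃ᵘ p ℚᵘ.* q
toℚᵘ-* {x} {y} x≃p y≃q = ℚᵘ.≃-trans (ℚ.toℚᵘ-homo-* x y) (ℚᵘ.*-cong x≃p y≃q)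

toℚᵘ-neg : ∀ {x p} → toℚᵘ x ≃ᵘ p → toℚᵘ (ℚ.- x) ≃ᵘ ℚᵘ.- p
toℚᵘ-neg {x} x≃p = ℚᵘ.≃-trans (ℚ.toℚᵘ-homo‿- x) (ℚᵘ.-‿cong x≃p)

module _ (D : ℤ) where

  represents-⊕ : ∀ {X Y p q p′ q′} → Represents X p q → Represents Y p′ q′ →
                 Represents (_⊕_ D X Y) (p ℚᵘ.+ p′) (q ℚᵘ.+ q′)
  represents-⊕ (represents a b) (represents c e) = represents (toℚᵘ-+ a c) (toℚᵘ-+ b e)

  represents-⊖ : ∀ {X p q} → Represents X p q → Represents (⊖_ D X) (ℚᵘ.- p) (ℚᵘ.- q)
  represents-⊖ (represents a b) = represents (toℚᵘ-neg a) (toℚᵘ-neg b)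

  represents-⊝ : ∀ {X Y p q p′ q′} → Represents X p q → Represents Y p′ q′ →
                 Represents (_⊝_ D X Y) (p ℚᵘ.- p′) (q ℚᵘ.- q′)
  represents-⊝ x y = represents-⊕ x (represents-⊖ y)

  represents-⊗ : ∀ {X Y p q p′ q′} → Represents X p q → Represents Y p′ q′ →
                 Represents (_⊗_ D X Y) (p ℚᵘ.* p′ ℚᵘ.+ q ℚᵘ.* q′ ℚᵘ.* mkℚᵘ D 0) (p ℚᵘ.* q′ ℚᵘ.+ q ℚᵘ.* p′)
  represents-⊗ (represents a b) (represents c e) =
    represents (toℚᵘ-+ (toℚᵘ-* a c) (toℚᵘ-* (toℚᵘ-* b e) (toℚᵘ-/ D 0)))
               (toℚᵘ-+ (toℚᵘ-* a e) (toℚᵘ-* b c))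

  Pos⇒Posℤ : ∀ {X A B n} → Represents X (mkℚᵘ A n) (mkℚᵘ B n) → Pos D X → Posℤ D A B
  Pos⇒Posℤ {X} {A} {B} {n} (represents a b) = λ
    { (inj₁ (0<a , inj₁ 0≤b))     → inj₁ (0<A 0<a , inj₁ (0≤B 0≤b))
    ; (inj₁ (0<a , inj₂ b²D<a²))  → inj₁ (0<A 0<a , inj₂ (B²D<A² b²D<a²))
    ; (inj₂ (a≤0 , 0<b , a²<b²D)) → inj₂ (A≤0 a≤0 , 0<B 0<b , A²<B²D a²<b²D) }
    where
    Dq : ℚ
    Dq = D ℚ./ 1
    square-re : toℚᵘ (re X ℚ.* re X) ≃ᵘ mkℚᵘ A n ℚᵘ.* mkℚᵘ A n
    square-re = toℚᵘ-* a a
    square-im-D : toℚᵘ (im X ℚ.* im X ℚ.* Dq) ≃ᵘ mkℚᵘ B n ℚᵘ.* mkℚᵘ B n ℚᵘ.* mkℚᵘ D 0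
    square-im-D = toℚᵘ-* (toℚᵘ-* b b) (toℚᵘ-/ D 0)
    k : ℕ
    k = suc n ℕ.* suc n
    cancelˡ : ∀ {x y} → x * + (k ℕ.* 1) < y * + k → x < y
    cancelˡ {x} {y} lt = ℤ.*-cancelʳ-<-nonNeg (+ k) (subst (λ m → x * + m < y * + k) (ℕ.*-identityʳ k) lt)
    cancelʳ : ∀ {x y} → x * + k < y * + (k ℕ.* 1) → x < y
    cancelʳ {x} {y} lt = ℤ.*-cancelʳ-<-nonNeg (+ k) (subst (λ m → x * + k < y * + m) (ℕ.*-identityʳ k) lt)
    0<A : ℚ.0ℚ ℚ.< re X → 0ℤ < A
    0<A h with ℚᵘ.<-respʳ-≃ a (ℚ.toℚᵘ-mono-< h)
    ... | *<* 0<A*1 = subst (0ℤ <_) (ℤ.*-identityʳ A) 0<A*1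
    0<B : ℚ.0ℚ ℚ.< im X → 0ℤ < B
    0<B h with ℚᵘ.<-respʳ-≃ b (ℚ.toℚᵘ-mono-< h)
    ... | *<* 0<B*1 = subst (0ℤ <_) (ℤ.*-identityʳ B) 0<B*1
    0≤B : ℚ.0ℚ ℚ.≤ im X → 0ℤ ≤ B
    0≤B h with ℚᵘ.≤-respʳ-≃ b (ℚ.toℚᵘ-mono-≤ h)
    ... | *≤* 0≤B*1 = subst (0ℤ ≤_) (ℤ.*-identityʳ B) 0≤B*1
    A≤0 : re X ℚ.≤ ℚ.0ℚ → A ≤ 0ℤ
    A≤0 h with ℚᵘ.≤-respˡ-≃ a (ℚ.toℚᵘ-mono-≤ h)
    ... | *≤* A*1≤0 = subst (_≤ 0ℤ) (ℤ.*-identityʳ A) A*1≤0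
    B²D<A² : im X ℚ.* im X ℚ.* Dq ℚ.< re X ℚ.* re X → B * B * D < A * A
    B²D<A² h with ℚᵘ.<-respʳ-≃ square-re (ℚᵘ.<-respˡ-≃ square-im-D (ℚ.toℚᵘ-mono-< h))
    ... | *<* lt = cancelʳ lt
    A²<B²D : re X ℚ.* re X ℚ.< im X ℚ.* im X ℚ.* Dq → A * A < B * B * D
    A²<B²D h with ℚᵘ.<-respʳ-≃ square-im-D (ℚᵘ.<-respˡ-≃ square-re (ℚ.toℚᵘ-mono-< h))
    ... | *<* lt = cancelˡ lt

represents-≃ : ∀ {X p q p′ q′} → Represents X p q → p ≃ᵘ p′ → q ≃ᵘ q′ → Represents X p′ q′
represents-≃ (represents a b) p≃p′ q≃q′ = represents (ℚᵘ.≃-trans a p≃p′) (ℚᵘ.≃-trans b q≃q′)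

-- Each surd below is (A + B √D)/2 for the stated A and B.  In the ≃ᵘ proofs,
-- matching against mkℚᵘ _ _ makes Agda compute the numerator of the ℚᵘ term,
-- which the ring solver cannot unfold by itself.

Pos[ρ-k]⇒Posℤ : ∀ D K L → Pos D (⊖_ D (_⊝_ D (ofℤ K) (ρ′ L))) → Posℤ D (L - + 2 * K) (+ 1)
Pos[ρ-k]⇒Posℤ D K L = Pos⇒Posℤ D {n = 1} (represents-≃
  (represents-⊖ D (represents-⊝ D (represents-ofℤ K) (represents-ρ L)))
  (*≡* {mkℚᵘ _ _} (solve (K ∷ L ∷ []))) (*≡* {mkℚᵘ _ _} (solve (K ∷ L ∷ []))))

Pos[σ-k]⇒Posℤ : ∀ D K L → Pos D (⊖_ D (_⊝_ D (ofℤ K) (σ′ L))) → Posℤ D (L - + 2 * K) (- + 1)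
Pos[σ-k]⇒Posℤ D K L = Pos⇒Posℤ D {n = 1} (represents-≃
  (represents-⊖ D (represents-⊝ D (represents-ofℤ K) (represents-σ L)))
  (*≡* {mkℚᵘ _ _} (solve (K ∷ L ∷ []))) (*≡* {mkℚᵘ _ _} (solve (K ∷ L ∷ []))))

Pos[v[d-ρ]-y[k-ρ]]⇒Posℤ : ∀ D V K L d y →
  Pos D (_⊝_ D (_⊗_ D (ofℤ V) (_⊝_ D (ofℤ d) (ρ′ L))) (_⊗_ D (ofℤ y) (_⊝_ D (ofℤ K) (ρ′ L)))) →
  Posℤ D (V * (+ 2 * d - L) - y * (+ 2 * K - L)) (y - V)
Pos[v[d-ρ]-y[k-ρ]]⇒Posℤ D V K L d y = Pos⇒Posℤ D {n = 1} (represents-≃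
  (represents-⊝ D (represents-⊗ D (represents-ofℤ V) (represents-⊝ D (represents-ofℤ d) (represents-ρ L)))
                  (represents-⊗ D (represents-ofℤ y) (represents-⊝ D (represents-ofℤ K) (represents-ρ L))))
  (*≡* {mkℚᵘ _ _} (solve (V ∷ K ∷ L ∷ D ∷ d ∷ y ∷ []))) (*≡* {mkℚᵘ _ _} (solve (V ∷ K ∷ L ∷ D ∷ d ∷ y ∷ []))))

Pos[y[k-σ]-v[d-σ]]⇒Posℤ : ∀ D V K L d y →
  Pos D (_⊝_ D (_⊗_ D (ofℤ y) (_⊝_ D (ofℤ K) (σ′ L))) (_⊗_ D (ofℤ V) (_⊝_ D (ofℤ d) (σ′ L)))) →
  Posℤ D (- (V * (+ 2 * d - L) - y * (+ 2 * K - L))) (y - V)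
Pos[y[k-σ]-v[d-σ]]⇒Posℤ D V K L d y = Pos⇒Posℤ D {n = 1} (represents-≃
  (represents-⊝ D (represents-⊗ D (represents-ofℤ y) (represents-⊝ D (represents-ofℤ K) (represents-σ L)))
                  (represents-⊗ D (represents-ofℤ V) (represents-⊝ D (represents-ofℤ d) (represents-σ L))))
  (*≡* {mkℚᵘ _ _} (solve (V ∷ K ∷ L ∷ D ∷ d ∷ y ∷ []))) (*≡* {mkℚᵘ _ _} (solve (V ∷ K ∷ L ∷ D ∷ d ∷ y ∷ []))))

module SRGArithmetic (v k lam mu : ℕ) (lam≤k : lam ℕ.≤ k) (mu≤k : mu ℕ.≤ k)
                     (srg-eq : k ℕ.* k ℕ.+ mu ℕ.* (k ℕ.+ 1) ≡ k ℕ.* (lam ℕ.+ 1) ℕ.+ mu ℕ.* v)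
                     (d : ℤ) (0≤d : 0ℤ ≤ d) (d≤k : d ≤ + k) (y : ℤ) where

  L D A B : ℤ
  L = + lam - + mu
  D = disc k lam mu
  A = + v * (+ 2 * d - L) - y * (+ 2 * + k - L)
  B = y - + v

  -- (2k - L)² - D = 4 (k - ρ)(k - σ) = 4 μ v
  [2k-L]²≡D+4μv : (+ 2 * + k - L) * (+ 2 * + k - L) ≡ D + + 4 * (+ mu * + v)
  [2k-L]²≡D+4μv = ≡-modulo (+ 4) (lemma (+ k) (+ lam) (+ mu) (+ v)) srgℤ
    where
    srgℤ : + k * + k + + mu * (+ k + + 1) ≡ + k * (+ lam + + 1) + + mu * + v
    srgℤ = trans (≡.sym (cong₂ _+_ (ℤ.pos-* k k) (ℤ.pos-* mu (k ℕ.+ 1))))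
                 (trans (cong +_ srg-eq) (cong₂ _+_ (ℤ.pos-* k (lam ℕ.+ 1)) (ℤ.pos-* mu v)))
    lemma : ∀ k lam mu v →
            (+ 2 * k - (lam - mu)) * (+ 2 * k - (lam - mu)) - ((lam - mu) * (lam - mu) + + 4 * (k - mu) + + 4 * (mu * v))
            ≡ + 4 * ((k * k + mu * (k + + 1)) - (k * (lam + + 1) + mu * v))
    lemma = solve-∀

  0≤2k-L : 0ℤ ≤ + 2 * + k - L
  0≤2k-L = subst (0ℤ ≤_) (lemma (+ k) (+ lam) (+ mu))
    (ℤ.+-mono-≤ (ℤ.+-mono-≤ (ℤ.i≤j⇒0≤j-i (+≤+ lam≤k)) (0≤+ k)) (0≤+ mu))
    where
    lemma : ∀ k lam mu → (k - lam) + k + mu ≡ + 2 * k - (lam - mu)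
    lemma = solve-∀

  D≤[2k-L]² : D ≤ (+ 2 * + k - L) * (+ 2 * + k - L)
  D≤[2k-L]² = subst (D ≤_) (≡.sym [2k-L]²≡D+4μv)
    (i≤i+nonNeg (*-nonNeg (0≤+ 4) (*-nonNeg (0≤+ mu) (0≤+ v))))

  L²≤D : L * L ≤ D
  L²≤D = i≤i+nonNeg (*-nonNeg (0≤+ 4) (ℤ.i≤j⇒0≤j-i (+≤+ mu≤k)))

  ρ≤k : ¬ Posℤ D (L - + 2 * + k) (+ 1)
  ρ≤k = ¬Posℤ-by-√D≤c (+ 2 * + k - L) (0≤+ 1) 0≤2k-L D≤[2k-L]² (ℤ.≤-reflexive (lemma (+ k) L))
    where
    lemma : ∀ k L → (L - + 2 * k) + + 1 * (+ 2 * k - L) ≡ 0ℤ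
    lemma = solve-∀

  σ≤k : ¬ Posℤ D (L - + 2 * + k) (- + 1)
  σ≤k = ¬Posℤ-by-c≤√D L ℤ.-≤+ L²≤D
    (subst (_≤ 0ℤ) (≡.sym (lemma (+ k) L)) (ℤ.neg-mono-≤ (*-nonNeg (0≤+ 2) (0≤+ k))))
    where
    lemma : ∀ k L → (L - + 2 * k) + - + 1 * L ≡ - (+ 2 * k)
    lemma = solve-∀

  below-Haem≤⇒gap : Posℤ D A B ⊎ Posℤ D (L - + 2 * + k) (+ 1) → y < + v × B * B * D < A * A
  below-Haem≤⇒gap (inj₂ ρ>k) = ⊥-elim (ρ≤k ρ>k)
  below-Haem≤⇒gap (inj₁ pos) with y ℤ.<? + v
  ... | yes y<v = y<v , proj₂ (Posℤ-im<0 pos (i<j⇒i-j<0 y<v))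
  ... | no y≮v = ⊥-elim (¬Posℤ-by-√D≤c (+ 2 * + k - L) (ℤ.i≤j⇒0≤j-i (ℤ.≮⇒≥ y≮v)) 0≤2k-L D≤[2k-L]² A+B[2k-L]≤0 pos)
    where
    -- v (d - ρ) - y (k - ρ) = v (d - k) - (y - v)(k - ρ) ≤ 0 once y ≥ v
    A+B[2k-L]≤0 : A + B * (+ 2 * + k - L) ≤ 0ℤ
    A+B[2k-L]≤0 = subst (_≤ 0ℤ) (≡.sym (lemma (+ v) (+ k) L d y))
      (ℤ.neg-mono-≤ (*-nonNeg (0≤+ 2) (*-nonNeg (0≤+ v) (ℤ.i≤j⇒0≤j-i d≤k))))
      where
      lemma : ∀ v k L d y → (v * (+ 2 * d - L) - y * (+ 2 * k - L)) + (y - v) * (+ 2 * k - L) ≡ - (+ 2 * (v * (k - d)))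
      lemma = solve-∀

  above-Haem≥⇒gap : y < + v → Posℤ D (- A) B ⊎ Posℤ D (L - + 2 * + k) (- + 1) → 0ℤ < y × B * B * D < A * A
  above-Haem≥⇒gap _ (inj₂ σ>k) = ⊥-elim (σ≤k σ>k)
  above-Haem≥⇒gap y<v (inj₁ pos) with 0ℤ ℤ.<? y
  ... | yes 0<y = 0<y , subst (B * B * D <_) (neg-square A) (proj₂ (Posℤ-im<0 pos (i<j⇒i-j<0 y<v)))
  ... | no 0≮y = ⊥-elim (¬Posℤ-by-c≤√D L (ℤ.<⇒≤ (i<j⇒i-j<0 y<v)) L²≤D -A+BL≤0 pos)
    where
    -- y (k - σ) ≤ 0 ≤ v (d - σ) once y ≤ 0, because σ ≤ 0
    -A+BL≤0 : - A + B * L ≤ 0ℤ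
    -A+BL≤0 = subst (_≤ 0ℤ) (≡.sym (lemma (+ v) (+ k) L d y))
      (ℤ.neg-mono-≤ (*-nonNeg (0≤+ 2) (ℤ.+-mono-≤ (*-nonNeg (0≤+ k) (ℤ.neg-mono-≤ (ℤ.≮⇒≥ 0≮y))) (*-nonNeg (0≤+ v) 0≤d))))
      where
      lemma : ∀ v k L d y → - (v * (+ 2 * d - L) - y * (+ 2 * k - L)) + (y - v) * L ≡ - (+ 2 * (k * - y + v * d))
      lemma = solve-∀

  R-negative : 0ℤ < y → y < + v → B * B * D < A * A → ∃[ b ] R v k lam mu b y d < 0ℤ
  R-negative 0<y y<v gap =
    let x , Q<0 = quadratic-negative a β C (i<j⇒0<j-i y<v) a²<Δ
    in  x , subst (_< 0ℤ) (≡.sym (R≡ x)) Q<0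
    where
    a β C : ℤ
    a = + v - y
    β = a - + 2 * y * (+ k - d)
    C = (L + + 1) * y * d + y * (y - + 1) * + mu - y * d * d

    R≡ : ∀ x → R v k lam mu x y d ≡ a * x * x + β * x + C
    R≡ x = lemma (+ v) (+ k) (+ lam) (+ mu) x y d
      where
      lemma : ∀ v k lam mu x y d →
              x * (x + + 1) * (v - y) - + 2 * x * y * k + (+ 2 * x + lam - mu + + 1) * y * d + y * (y - + 1) * mu - y * d * d
              ≡ (v - y) * x * x + ((v - y) - + 2 * y * (k - d)) * x + ((lam - mu + + 1) * y * d + y * (y - + 1) * mu - y * d * d)
      lemma = solve-∀

    excess : + v * ((β * β - + 4 * a * C) - a * a) ≡ y * (A * A - B * B * D)
    excess = ≡-modulo (y * y * (+ v - y)) (lemma (+ v) (+ k) L (+ mu) d y) [2k-L]²≡D+4μv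
      where
      lemma : ∀ v k L mu d y →
        let a = v - y ; β = a - + 2 * y * (k - d) ; C = (L + + 1) * y * d + y * (y - + 1) * mu - y * d * d
            A = v * (+ 2 * d - L) - y * (+ 2 * k - L) ; B = y - v ; D = L * L + + 4 * (k - mu)
        in  v * ((β * β - + 4 * a * C) - a * a) - y * (A * A - B * B * D)
            ≡ y * y * (v - y) * ((+ 2 * k - L) * (+ 2 * k - L) - (D + + 4 * (mu * v)))
      lemma = solve-∀

    a²<Δ : a * a < β * β - + 4 * a * C
    a²<Δ = 0<j-i⇒i<j (0<i*j⇒0<j (0≤+ v) (subst (0ℤ <_) (≡.sym excess) (*-pos 0<y (i<j⇒0<j-i gap))))

  Haem-gap : (0ℤ < y × BelowHaemLe v k lam mu d y) ⊎ (AboveHaemGe v k lam mu d y × y < + v) →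
             0ℤ < y × y < + v × B * B * D < A * A
  Haem-gap (inj₁ (0<y , below)) = 0<y , below-Haem≤⇒gap (below-coordinates below)
    where
    below-coordinates : BelowHaemLe v k lam mu d y → Posℤ D A B ⊎ Posℤ D (L - + 2 * + k) (+ 1)
    below-coordinates (inj₁ (_ , pos)) = inj₁ (Pos[v[d-ρ]-y[k-ρ]]⇒Posℤ D (+ v) (+ k) L d y pos)
    below-coordinates (inj₂ (neg , _)) = inj₂ (Pos[ρ-k]⇒Posℤ D (+ k) L neg)
  Haem-gap (inj₂ (above , y<v)) =
    let 0<y , gap = above-Haem≥⇒gap y<v (above-coordinates above) in 0<y , y<v , gap
    where
    above-coordinates : AboveHaemGe v k lam mu d y → Posℤ D (- A) B ⊎ Posℤ D (L - + 2 * + k) (- + 1)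
    above-coordinates (inj₁ (_ , pos)) = inj₁ (Pos[y[k-σ]-v[d-σ]]⇒Posℤ D (+ v) (+ k) L d y pos)
    above-coordinates (inj₂ (neg , _)) = inj₂ (Pos[σ-k]⇒Posℤ D (+ k) L neg)

lemma5p2 : ∀ {v : ℕ} (G : Graph v) (k lam mu : ℕ) → IsSRG G k lam mu → mu ≢ 0
    → (d : ℤ) → + 0 ≤ d → d ≤ + k
    → (y : ℤ)
    → ((+ 0 < y × BelowHaemLe v k lam mu d y) ⊎ (AboveHaemGe v k lam mu d y × y < + v))
    → ∃[ b ] (R v k lam mu b y d < + 0)
lemma5p2 {v} G k lam mu srg _ d 0≤d d≤k y window =
  let 0<y , y<v , gap = Haem-gap window in R-negative 0<y y<v gap
  where
  open SRGArithmetic v k lam mu (lam≤k srg) (mu≤k srg) (srg-identity srg) d 0≤d d≤k y
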